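{- For all integers $m,n\ge 3$, the graphs $K_m\times P_n$ and $K_m\times C_n$ each admit a self-identifying code.
   Context: For a vertex $v$, $N[v]$ is its closed neighborhood. A nonempty set $S\subseteq V(G)$ is a self-identifying code of $G$ if for every vertex $v\in V(G)$: (1) $N[v]\cap S\neq\emptyset$, and (2) $\bigcap_{c\in N[v]\cap S}N[c]=\{v\}$. With $V(K_m)=\{v_0,\dots,v_{m-1}\}$ and $V(P_n)=V(C_n)=\{0,\dots,n-1\}$ (consecutively numbered), the direct product $K_m\times P_n$ has vertices $(v_i,j)$, with $(v_i,j)$ adjacent to $(v_{i'},j')$ iff $i\neq i'$ and $|j-j'|=1$; in $K_m\times C_n$, $(v_i,j)$ is adjacent to $(v_{i'},j')$ iff $i\ne i'$ and $j-j'\equiv\pm1\pmod n$. -}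

module Defs where

open import Data.Nat using (ℕ; suc; _+_)
open import Data.Fin using (Fin; toℕ)
open import Data.Product using (_×_; Σ; ∃; ∃-syntax; _,_)
open import Data.Sum using (_⊎_)
open import Relation.Binary.PropositionalEquality using (_≡_; _≢_)
open import Relation.Nullary using (¬_)
open import Level using (0ℓ)

record Graph : Set₁ where
  field
    V   : Set
    Adj : V → V → Set

open Graph public

_∈N[_]of_ : {G : Graph} → V G → V G → Set
_∈N[_]of_ {G} u v = (u ≡ v) ⊎ Adj G u v

VSet : Graph → Set₁
VSet G = V G → Set

-- Self-identifying code (as in the paper):
--  S nonempty, and for every vertex v:
--   (1) N[v] ∩ S ≠ ∅
--   (2) ⋂_{c ∈ N[v] ∩ S} N[c] = {v}.
-- (v always lies in this intersection, so (2) amounts to: every w in the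
--  intersection equals v; we state both inclusions literally anyway.)
record IsSelfIdentifyingCode (G : Graph) (S : VSet G) : Set where
  field
    nonempty : ∃[ s ] S s
    dominating : ∀ (v : V G) → ∃[ c ] (_∈N[_]of_ {G} c v × S c)
    identifying-⊆ : ∀ (v w : V G) →
      (∀ (c : V G) → _∈N[_]of_ {G} c v → S c → _∈N[_]of_ {G} w c) → w ≡ v
    identifying-⊇ : ∀ (v c : V G) → _∈N[_]of_ {G} c v → S c → _∈N[_]of_ {G} v c

HasSelfIdentifyingCode : Graph → Set₁
HasSelfIdentifyingCode G = Σ (VSet G) (IsSelfIdentifyingCode G)

KmxPn : ℕ → ℕ → Graph
KmxPn m n = record
  { V   = Fin m × Fin n
  ; Adj = λ { (i , j) (i' , j') → (i ≢ i') × ((suc (toℕ j) ≡ toℕ j') ⊎ (suc (toℕ j') ≡ toℕ j)) } }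

CycSucc : {n : ℕ} → Fin n → Fin n → Set
CycSucc {n} j j' = (suc (toℕ j) ≡ toℕ j') ⊎ ((suc (toℕ j) ≡ n) × (toℕ j' ≡ 0))

KmxCn : ℕ → ℕ → Graph
KmxCn m n = record
  { V   = Fin m × Fin n
  ; Adj = λ { (i , j) (i' , j') → (i ≢ i') × (CycSucc j j' ⊎ CycSucc j' j) } }

module Submission where

-- In K_m × H with m ≥ 3, a neighbour w = (i' , j') of v = (i , j) is separated from v by
-- the vertex (k , j') with k ∉ {i , i'}: it is adjacent to v, but not to w because H has
-- no loops. Hence the whole vertex set is a self-identifying code.

open import Defs
open import Data.Nat using (ℕ; _≥_; _+_; suc; s≤s)
open import Data.Nat.Properties using (1+n≢n; 0≢1+n; suc-injective)
open import Data.Fin using (Fin; toℕ) renaming (zero to fz; suc to fs)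
open import Data.Fin.Properties using (_≟_)
open import Data.Product using (_×_; _,_; ∃-syntax; proj₁)
open import Data.Sum using (_⊎_; inj₁; inj₂; swap)
open import Data.Unit using (⊤; tt)
open import Data.Empty using (⊥-elim)
open import Relation.Nullary using (yes; no; ¬_)
open import Relation.Binary.Definitions using (Symmetric; Irreflexive)
open import Relation.Binary.PropositionalEquality using (_≡_; _≢_; refl; sym; trans; cong)

module _ (G : Graph) where

  Everything : VSet G
  Everything _ = ⊤

  everything-isSelfIdentifyingCode :
    V G → Symmetric (Adj G) →
    (∀ v w → Adj G w v → ∃[ c ] (_∈N[_]of_ {G} c v × ¬ _∈N[_]of_ {G} w c)) →
    IsSelfIdentifyingCode G Everything
  everything-isSelfIdentifyingCode v₀ adj-sym separated = record
    { nonempty      = v₀ , tt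
    ; dominating    = λ v → v , inj₁ refl , tt
    ; identifying-⊆ = identifying
    ; identifying-⊇ = λ { v c (inj₁ refl) _ → inj₁ refl ; v c (inj₂ c~v) _ → inj₂ (adj-sym c~v) }
    }
    where
    identifying : ∀ v w → (∀ c → _∈N[_]of_ {G} c v → Everything c → _∈N[_]of_ {G} w c) → w ≡ v
    identifying v w w∈⋂ with w∈⋂ v (inj₁ refl) tt
    ... | inj₁ w≡v = w≡v
    ... | inj₂ w~v with separated v w w~v
    ...   | c , c∈N[v] , w∉N[c] = ⊥-elim (w∉N[c] (w∈⋂ c c∈N[v] tt))

avoid-two : ∀ {m} → m ≥ 3 → (a b : Fin m) → ∃[ k ] (k ≢ a × k ≢ b)
avoid-two (s≤s (s≤s (s≤s _))) a b with fz ≟ a | fz ≟ b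
... | no 0≢a   | no 0≢b = fz , 0≢a , 0≢b
... | yes refl | _ with fs fz ≟ b
...   | no 1≢b   = fs fz , (λ ()) , 1≢b
...   | yes refl = fs (fs fz) , (λ ()) , (λ ())
avoid-two (s≤s (s≤s (s≤s _))) a b | no _ | yes refl with fs fz ≟ a
...   | no 1≢a   = fs fz , 1≢a , (λ ())
...   | yes refl = fs (fs fz) , (λ ()) , (λ ())

module _ (m : ℕ) {B : Set} (L : B → B → Set) where

  K× : Graph
  K× = record { V = Fin m × B ; Adj = λ { (i , j) (i' , j') → (i ≢ i') × L j j' } }

  K×-hasSelfIdentifyingCode :
    m ≥ 3 → B → Symmetric L → Irreflexive _≡_ L → HasSelfIdentifyingCode K×
  K×-hasSelfIdentifyingCode m≥3 b L-sym L-irrefl =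
    Everything K× , everything-isSelfIdentifyingCode K× (i₀ m≥3 , b) adj-sym separated
    where
    i₀ : m ≥ 3 → Fin m
    i₀ (s≤s _) = fz

    adj-sym : Symmetric (Adj K×)
    adj-sym (i≢i' , l) = (λ i'≡i → i≢i' (sym i'≡i)) , L-sym l

    separated : ∀ v w → Adj K× w v →
      ∃[ c ] (_∈N[_]of_ {K×} c v × ¬ _∈N[_]of_ {K×} w c)
    separated (i , j) (i' , j') (i'≢i , l) with avoid-two m≥3 i i'
    ... | k , k≢i , k≢i' = (k , j') , inj₂ (k≢i , l) , w∉N[c]
      where
      w∉N[c] : ¬ _∈N[_]of_ {K×} (i' , j') (k , j')
      w∉N[c] (inj₁ w≡c)     = k≢i' (sym (cong proj₁ w≡c))
      w∉N[c] (inj₂ (_ , l')) = L-irrefl refl l'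

module _ {B : Set} (R : B → B → Set) where

  Symmetrize : B → B → Set
  Symmetrize a b = R a b ⊎ R b a

  symmetrize-symmetric : Symmetric Symmetrize
  symmetrize-symmetric = swap

  symmetrize-irreflexive : Irreflexive _≡_ R → Irreflexive _≡_ Symmetrize
  symmetrize-irreflexive R-irrefl a≡b (inj₁ r) = R-irrefl a≡b r
  symmetrize-irreflexive R-irrefl a≡b (inj₂ r) = R-irrefl (sym a≡b) r

PathSucc : ∀ {n} → Fin n → Fin n → Set
PathSucc j j' = suc (toℕ j) ≡ toℕ j'

pathSucc-irreflexive : ∀ {n} → Irreflexive _≡_ (PathSucc {n})
pathSucc-irreflexive refl = 1+n≢n

-- The wrap-around edge is a loop only on C₁.
cycSucc-irreflexive : ∀ {n} → Irreflexive _≡_ (CycSucc {2 + n})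
cycSucc-irreflexive refl (inj₁ 1+j≡j)           = 1+n≢n 1+j≡j
cycSucc-irreflexive refl (inj₂ (1+j≡2+n , j≡0)) = 0≢1+n (trans (sym j≡0) (suc-injective 1+j≡2+n))

lemma5 : ∀ (m n : ℕ) → m ≥ 3 → n ≥ 3 →
    HasSelfIdentifyingCode (KmxPn m n) × HasSelfIdentifyingCode (KmxCn m n)
lemma5 m _ m≥3 (s≤s (s≤s (s≤s _))) =
  K×-hasSelfIdentifyingCode m (Symmetrize PathSucc) m≥3 fz
    (symmetrize-symmetric PathSucc) (symmetrize-irreflexive PathSucc pathSucc-irreflexive) ,
  K×-hasSelfIdentifyingCode m (Symmetrize CycSucc) m≥3 fz
    (symmetrize-symmetric CycSucc) (symmetrize-irreflexive CycSucc cycSucc-irreflexive)
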